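{- Let $n\ge 3$. Then $\operatorname{Det}(\mathrm{PX}(4,1))=6$ and $\operatorname{Dist}(\mathrm{PX}(4,1))=5$, and for all $n\neq 4$, $\operatorname{Det}(\mathrm{PX}(n,1))=n$ and $\operatorname{Dist}(\mathrm{PX}(n,1))=3$.
   Context: For integers $n\ge 3$ and $1\le k<n$, the Praeger–Xu graph $\mathrm{PX}(n,k)$ is the simple graph with vertex set $\mathbb Z_n\times\mathbb Z_2^k$; a vertex is written $(i,x)$ with $x=x_0x_1\cdots x_{k-1}$ a bitstring of length $k$. Two vertices $(i,x)$ and $(j,y)$ are adjacent if and only if (after possibly swapping the two vertices) $j=i+1$ in $\mathbb Z_n$ and $x=az_1\cdots z_{k-1}$, $y=z_1\cdots z_{k-1}b$ for some bits $a,b,z_1,\dots,z_{k-1}\in\mathbb Z_2$ (for $k=1$ this means $(i,x)$ is adjacent to both vertices $(i\pm1,0),(i\pm1,1)$). For a graph $G$, a set $S\subseteq V(G)$ is a determining set if the only automorphism of $G$ fixing every vertex of $S$ is the identity, and $\operatorname{Det}(G)$ is the minimum size of a determining set. $\operatorname{Dist}(G)$ is the least $d$ such that the vertices can be colored with $d$ colors so that the only automorphism preserving every color class setwise is the identity. -}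

module Defs where

open import Data.Nat using (ℕ; zero; suc; _≤_)
open import Data.Fin using (Fin; toℕ)
open import Data.Bool using (Bool)
open import Data.Vec using (Vec; _∷_; _∷ʳ_)
open import Data.List using (List; length)
open import Data.List.Relation.Unary.Unique.Propositional using (Unique)
open import Data.List.Membership.Propositional using (_∈_)
open import Data.Product using (Σ; ∃; _×_; _,_)
open import Data.Sum using (_⊎_)
open import Function.Bundles using (_↔_; Inverse; _⇔_)
open import Relation.Binary.PropositionalEquality using (_≡_)

record Graph : Set₁ where
  field
    Vertex : Set
    Adj    : Vertex → Vertex → Set
open Graph public

Succ : {n : ℕ} → Fin n → Fin n → Set
Succ {n} i j = (toℕ j ≡ suc (toℕ i)) ⊎ ((toℕ j ≡ 0) × (suc (toℕ i) ≡ n))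

-- Directed half of the Praeger–Xu adjacency, for PX(n, suc k):
-- (i,x) → (i+1,y) with x = a z, y = z b.
PXArc : (n k : ℕ) → (Fin n × Vec Bool (suc k)) → (Fin n × Vec Bool (suc k)) → Set
PXArc n k (i , x) (j , y) =
  Succ i j × Σ Bool λ a → Σ Bool λ b → Σ (Vec Bool k) λ z → (x ≡ a ∷ z) × (y ≡ z ∷ʳ b)

-- PX n k  is the Praeger–Xu graph PX(n, k+1)  (so k ≥ 1 is built in).
PX : ℕ → ℕ → Graph
PX n k = record
  { Vertex = Fin n × Vec Bool (suc k)
  ; Adj    = λ u v → PXArc n k u v ⊎ PXArc n k v u
  }

record Aut (G : Graph) : Set where
  field
    perm     : Vertex G ↔ Vertex G
    preserve : ∀ u v → Adj G u v ⇔ Adj G (Inverse.to perm u) (Inverse.to perm v)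
open Aut public

apply : {G : Graph} → Aut G → Vertex G → Vertex G
apply σ = Inverse.to (perm σ)

IsIdentity : {G : Graph} → Aut G → Set
IsIdentity {G} σ = ∀ v → apply σ v ≡ v

Determining : (G : Graph) → List (Vertex G) → Set
Determining G S = ∀ (σ : Aut G) → (∀ v → v ∈ S → apply σ v ≡ v) → IsIdentity σ

DetIs : Graph → ℕ → Set
DetIs G d =
  (Σ (List (Vertex G)) λ S → Unique S × length S ≡ d × Determining G S)
  × (∀ (S : List (Vertex G)) → Unique S → Determining G S → d ≤ length S)

Distinguishing : (G : Graph) (m : ℕ) → (Vertex G → Fin m) → Set
Distinguishing G m c = ∀ (σ : Aut G) → (∀ v → c (apply σ v) ≡ c v) → IsIdentity σ

DistIs : Graph → ℕ → Set
DistIs G d =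
  (Σ (Vertex G → Fin d) λ c → Distinguishing G d c)
  × (∀ (m : ℕ) (c : Vertex G → Fin m) → Distinguishing G m c → d ≤ m)

module Submission where

open import Defs
open import Data.Nat using (ℕ; _≤_)
open import Data.Product using (_×_)
open import Relation.Binary.PropositionalEquality using (_≢_)

open import Data.Bool using (Bool; true; false; not)
import Data.Bool.Properties as Boolₚ
open import Data.Empty using (⊥; ⊥-elim)
open import Data.Fin as Fin using (Fin; toℕ; fromℕ<; opposite; #_)
import Data.Fin.Properties as Finₚ
open import Data.List using (List; []; _∷_; length; filter; tabulate; _++_)
import Data.List.Properties as Listₚ
open import Data.List.Membership.Propositional using (_∈_; _∉_)
import Data.List.Membership.Propositional.Properties as ∈ₚ
open import Data.List.Membership.DecPropositional using () renaming (_∈?_ to ∈?[_])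
import Data.List.Relation.Unary.All as All
open import Data.List.Relation.Unary.AllPairs as AllPairs using (AllPairs; []; _∷_)
open import Data.List.Relation.Unary.Any using (here; there; _─_)
open import Data.List.Relation.Unary.Unique.Propositional using (Unique)
import Data.List.Relation.Unary.Unique.Propositional.Properties as Uniqueₚ
open import Data.List.Relation.Unary.Unique.DecPropositional using (unique?)
open import Data.Nat as ℕ using (zero; suc; _<_; _∸_; z≤n; s≤s; _+_)
import Data.Nat.Properties as ℕₚ
open import Data.Product using (Σ; _,_; proj₁; proj₂)
import Data.Product.Properties as ×ₚ
open import Data.Sum using (_⊎_; inj₁; inj₂)
open import Data.Unit using (⊤; tt)
open import Data.Vec using (Vec; []; _∷_; head)
import Data.Vec.Properties as Vecₚ
open import Function using (case_of_; _∘_)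
open import Function.Bundles using (Inverse; _⇔_; mk⇔; mk↔ₛ′; Equivalence)
open import Relation.Binary.PropositionalEquality
  using (_≡_; refl; sym; trans; cong; subst; subst₂; module ≡-Reasoning)
open import Relation.Nullary using (Dec; yes; no; ¬_; ¬?)
open import Relation.Nullary.Decidable using (map′; _⊎-dec_; _×-dec_; _→-dec_; from-yes)

-- PX(n,1) is the cycle C_n with every vertex replaced by a pair of twins (adjacency only depends
-- on the blocks).  Exchanging two twins is an automorphism, so a determining set contains all
-- but at most one vertex of each set of pairwise twins, and a distinguishing colouring is
-- injective on it.  For n ≠ 4 distinct vertices of C_n have distinct neighbourhoods, so the
-- twin classes are exactly the blocks and every automorphism permutes the blocks: fixing one
-- vertex in each block then fixes everything, giving Det = n.  Three colours suffice, as marking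
-- blocks 0 and 1 rigidifies the cycle, and two do not, since the reflection of the cycle lifts
-- to an automorphism preserving any 2-colouring that separates twins.  For n = 4 the graph is
-- K₄,₄ whose two sides are twin classes of size 4, whence Det = 3 + 3; a 4-colouring injective
-- on both sides would be preserved by exchanging the sides, so Dist = 5.

module _ {A : Set} where

  ∈-─ : ∀ {x y : A} {xs} (x∈xs : x ∈ xs) → y ∈ xs → y ≢ x → y ∈ (xs ─ x∈xs)
  ∈-─ (here refl) (here refl) y≢x = ⊥-elim (y≢x refl)
  ∈-─ (here refl) (there y∈xs) _  = y∈xs
  ∈-─ (there _)   (here refl)  _  = here refl
  ∈-─ (there x∈xs) (there y∈xs) y≢x = there (∈-─ x∈xs y∈xs y≢x)

  unique-⊆⇒length≤ : ∀ {xs ys : List A} → Unique xs → (∀ {x} → x ∈ xs → x ∈ ys) →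
                     length xs ≤ length ys
  unique-⊆⇒length≤ {[]}     _              _   = z≤n
  unique-⊆⇒length≤ {x ∷ xs} {ys} (x∉xs ∷ xs!) xs⊆ys = begin
    suc (length xs)          ≤⟨ s≤s (unique-⊆⇒length≤ xs! (λ y∈xs →
                                  ∈-─ x∈ys (xs⊆ys (there y∈xs)) (λ { refl → All.lookup x∉xs y∈xs refl }))) ⟩
    suc (length (ys ─ x∈ys)) ≡⟨ sym (Listₚ.length-removeAt′ ys _) ⟩
    length ys                ∎
    where
    open ℕₚ.≤-Reasoning
    x∈ys = xs⊆ys (here refl)

  length≤suc-length-filter : ∀ {P : A → Set} (P? : ∀ x → Dec (P x)) {xs} →
                             AllPairs (λ x y → P x ⊎ P y) xs → length xs ≤ suc (length (filter P? xs))
  length≤suc-length-filter P? {[]} [] = z≤n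
  length≤suc-length-filter {P} P? {x ∷ xs} (x-pairs ∷ pairs) with P? x
  ... | yes _  = s≤s (length≤suc-length-filter P? pairs)
  ... | no ¬px = s≤s (ℕₚ.≤-reflexive (sym (cong length (Listₚ.filter-all P? (All.map others x-pairs)))))
    where
    others : ∀ {y} → P x ⊎ P y → P y
    others (inj₁ px) = ⊥-elim (¬px px)
    others (inj₂ py) = py

injective⇒surjective : ∀ {n} {f : Fin n → Fin n} → (∀ {a b} → f a ≡ f b → a ≡ b) →
                       ∀ k → Σ (Fin n) λ l → f l ≡ k
injective⇒surjective {n} {f} f-inj k with Finₚ.any? (λ l → f l Finₚ.≟ k)
... | yes hit = hit
injective⇒surjective {suc n} {f} f-inj k | no miss =
  ⊥-elim (ℕₚ.1+n≰n (Finₚ.injective⇒≤ {f = g} g-injective))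
  where
  k≢f : ∀ l → k ≢ f l
  k≢f l k≡fl = miss (l , sym k≡fl)
  -- f misses k, so it factors through Fin n by removing k
  g : Fin (suc n) → Fin n
  g l = Fin.punchOut (k≢f l)
  g-injective : ∀ {a b} → g a ≡ g b → a ≡ b
  g-injective {a} {b} eq = f-inj (Finₚ.punchOut-injective (k≢f a) (k≢f b) eq)

injection⇒≤length : ∀ {A : Set} {n} {f : Fin n → A} {xs} → (∀ {i j} → f i ≡ f j → i ≡ j) →
                    (∀ i → f i ∈ xs) → n ≤ length xs
injection⇒≤length {f = f} f-inj f∈xs =
  subst (_≤ _) (Listₚ.length-tabulate f)
    (unique-⊆⇒length≤ (Uniqueₚ.tabulate⁺ f-inj) λ v∈ → case ∈ₚ.∈-tabulate⁻ v∈ of λ { (i , refl) → f∈xs i })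

-- Twins and automorphisms

Twins : (G : Graph) → Vertex G → Vertex G → Set
Twins G u v = ∀ w → Adj G w u ⇔ Adj G w v

Twins-refl : ∀ {G} u → Twins G u u
Twins-refl u w = mk⇔ (λ a → a) (λ a → a)

Twins-sym : ∀ {G u v} → Twins G u v → Twins G v u
Twins-sym tw w = mk⇔ (Equivalence.from (tw w)) (Equivalence.to (tw w))

module _ {G : Graph} (σ : Aut G) where

  unapply : Vertex G → Vertex G
  unapply = Inverse.from (perm σ)

  apply-unapply : ∀ v → apply σ (unapply v) ≡ v
  apply-unapply = Inverse.strictlyInverseˡ (perm σ)

  apply-injective : ∀ {u v} → apply σ u ≡ apply σ v → u ≡ v
  apply-injective {u} {v} eq = begin
    u                        ≡⟨ sym (Inverse.strictlyInverseʳ (perm σ) u) ⟩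
    unapply (apply σ u)      ≡⟨ cong unapply eq ⟩
    unapply (apply σ v)      ≡⟨ Inverse.strictlyInverseʳ (perm σ) v ⟩
    v                        ∎
    where open ≡-Reasoning

  apply-preserves-adj : ∀ {u v} → Adj G u v → Adj G (apply σ u) (apply σ v)
  apply-preserves-adj {u} {v} = Equivalence.to (preserve σ u v)

  apply-reflects-adj : ∀ {u v} → Adj G (apply σ u) (apply σ v) → Adj G u v
  apply-reflects-adj {u} {v} = Equivalence.from (preserve σ u v)

  apply-preserves-twins : ∀ {u v} → Twins G u v → Twins G (apply σ u) (apply σ v)
  apply-preserves-twins {u} {v} tw w = mk⇔ (transport u v tw) (transport v u (Twins-sym {G} tw))
    where
    transport : ∀ x y → Twins G x y → Adj G w (apply σ x) → Adj G w (apply σ y)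
    transport x y t a = subst (λ z → Adj G z (apply σ y)) (apply-unapply w)
      (apply-preserves-adj (Equivalence.to (t (unapply w))
        (apply-reflects-adj (subst (λ z → Adj G z (apply σ x)) (sym (apply-unapply w)) a))))

involution⇒aut : {G : Graph} (f : Vertex G → Vertex G) → (∀ v → f (f v) ≡ v) →
                 (∀ {u v} → Adj G u v → Adj G (f u) (f v)) → Aut G
involution⇒aut {G} f f-involutive f-preserves = record
  { perm     = mk↔ₛ′ f f f-involutive f-involutive
  ; preserve = λ u v → mk⇔ f-preserves (λ a → subst₂ (Adj G) (f-involutive u) (f-involutive v) (f-preserves a))
  }

module _ {G : Graph} (σ : Aut G) {F : Vertex G → Set} (F? : ∀ v → Dec (F v))
         (fixes-F : ∀ s → F s → apply σ s ≡ s) where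

  fixed-if-pinned : ∀ {Q : Vertex G → Set} v → Q (apply σ v) →
    (∀ w → ¬ F w → Q w → (∀ s → F s → Adj G s v ⇔ Adj G s w) → w ≡ v) →
    apply σ v ≡ v
  fixed-if-pinned v Qσv pinned with F? (apply σ v)
  ... | yes Fσv = apply-injective σ (fixes-F _ Fσv)
  ... | no ¬Fσv = pinned (apply σ v) ¬Fσv Qσv λ s Fs → mk⇔
    (λ s~v  → subst (λ z → Adj G z (apply σ v)) (fixes-F s Fs) (apply-preserves-adj σ s~v))
    (λ s~σv → apply-reflects-adj σ (subst (λ z → Adj G z (apply σ v)) (sym (fixes-F s Fs)) s~σv))

Pins : (G : Graph) → List (Vertex G) → Set
Pins G S = ∀ v w → v ∉ S → w ∉ S → (∀ s → s ∈ S → Adj G s v → Adj G s w) → w ≡ v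

module _ {G : Graph} (_≟_ : (u v : Vertex G) → Dec (u ≡ v))
         (adj-sym : ∀ {u v} → Adj G u v → Adj G v u) where

  module Transposition (u v : Vertex G) (u≢v : u ≢ v) where

    swap : Vertex G → Vertex G
    swap x with x ≟ u | x ≟ v
    ... | yes _ | _     = v
    ... | no _  | yes _ = u
    ... | no _  | no _  = x

    swap-u : swap u ≡ v
    swap-u with u ≟ u
    ... | yes _  = refl
    ... | no u≢u = ⊥-elim (u≢u refl)

    swap-v : swap v ≡ u
    swap-v with v ≟ u | v ≟ v
    ... | yes v≡u | _      = ⊥-elim (u≢v (sym v≡u))
    ... | no _    | yes _  = refl
    ... | no _    | no v≢v = ⊥-elim (v≢v refl)

    swap-other : ∀ {x} → x ≢ u → x ≢ v → swap x ≡ x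
    swap-other {x} x≢u x≢v with x ≟ u | x ≟ v
    ... | yes x≡u | _       = ⊥-elim (x≢u x≡u)
    ... | no _    | yes x≡v = ⊥-elim (x≢v x≡v)
    ... | no _    | no _    = refl

    swap-involutive : ∀ x → swap (swap x) ≡ x
    swap-involutive x with x ≟ u | x ≟ v
    ... | yes refl | _        = swap-v
    ... | no _     | yes refl = swap-u
    ... | no x≢u   | no x≢v   = swap-other x≢u x≢v

    module _ (tw : Twins G u v) where

      Twins-swap : ∀ x → Twins G x (swap x)
      Twins-swap x with x ≟ u | x ≟ v
      ... | yes refl | _        = tw
      ... | no _     | yes refl = Twins-sym {G} tw
      ... | no _     | no _     = Twins-refl {G} x

      swap-aut : Aut G
      swap-aut = involution⇒aut swap swap-involutive preserves
        where
        preserves : ∀ {a b} → Adj G a b → Adj G (swap a) (swap b)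
        preserves {a} {b} a~b = adj-sym (Equivalence.to (Twins-swap a (swap b))
                                  (adj-sym (Equivalence.to (Twins-swap b a) a~b)))

  module _ {u v : Vertex G} (tw : Twins G u v) (u≢v : u ≢ v) where
    open Transposition u v u≢v

    determining-meets-twins : ∀ {S} → Determining G S → u ∈ S ⊎ v ∈ S
    determining-meets-twins {S} det with ∈?[ _≟_ ] u S | ∈?[ _≟_ ] v S
    ... | yes u∈S | _       = inj₁ u∈S
    ... | no _    | yes v∈S = inj₂ v∈S
    ... | no u∉S  | no v∉S  = ⊥-elim (u≢v (trans (sym (det (swap-aut tw) fixes-S u)) swap-u))
      where
      fixes-S : ∀ x → x ∈ S → swap x ≡ x
      fixes-S x x∈S = swap-other (λ { refl → u∉S x∈S }) (λ { refl → v∉S x∈S })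

    distinguishing-separates-twins : ∀ {m c} → Distinguishing G m c → c u ≢ c v
    distinguishing-separates-twins {c = c} dist cu≡cv =
      u≢v (trans (sym (dist (swap-aut tw) preserves-c u)) swap-u)
      where
      preserves-c : ∀ x → c (swap x) ≡ c x
      preserves-c x with x ≟ u | x ≟ v
      ... | yes refl | _        = sym cu≡cv
      ... | no _     | yes refl = cu≡cv
      ... | no _     | no _     = refl

  pins⇒determining : ∀ {S} → Pins G S → Determining G S
  pins⇒determining {S} pins σ fixes-S v with ∈?[ _≟_ ] v S
  ... | yes v∈S = fixes-S v v∈S
  ... | no v∉S  = fixed-if-pinned σ (λ x → ∈?[ _≟_ ] x S) fixes-S {Q = λ _ → ⊤} v tt
                    (λ w w∉S _ nbhd → pins v w v∉S w∉S λ s s∈S → Equivalence.to (nbhd s s∈S))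

  determining-omits-≤1-twin : ∀ {S L} → Determining G S →
    AllPairs (λ x y → x ≢ y × Twins G x y) L → length L ≤ suc (length (filter (λ x → ∈?[ _≟_ ] x S) L))
  determining-omits-≤1-twin det pairs =
    length≤suc-length-filter _ (AllPairs.map (λ (x≢y , tw) → determining-meets-twins tw x≢y det) pairs)

-- The cycle C_n

-- Succ i j unfolds to Succℕ n (toℕ i) (toℕ j)
Succℕ : ℕ → ℕ → ℕ → Set
Succℕ n a b = (b ≡ suc a) ⊎ ((b ≡ 0) × (suc a ≡ n))

CycleAdjℕ : ℕ → ℕ → ℕ → Set
CycleAdjℕ n a b = Succℕ n a b ⊎ Succℕ n b a

CycleAdj : {n : ℕ} → Fin n → Fin n → Set
CycleAdj i j = Succ i j ⊎ Succ j i

EqOrTwoAfter : ℕ → ℕ → ℕ → Set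
EqOrTwoAfter n a b =
  (a ≡ b) ⊎ (b ≡ suc (suc a)) ⊎ ((b ≡ 0) × (suc (suc a) ≡ n)) ⊎ ((suc a ≡ n) × (b ≡ 1))

module _ {n : ℕ} where

  neighbour-of-successor : ∀ {a p b} → Succℕ n a p → CycleAdjℕ n p b → EqOrTwoAfter n a b
  neighbour-of-successor (inj₁ refl)            (inj₁ (inj₁ refl))           = inj₂ (inj₁ refl)
  neighbour-of-successor (inj₁ refl)            (inj₁ (inj₂ (refl , a+2≡n))) = inj₂ (inj₂ (inj₁ (refl , a+2≡n)))
  neighbour-of-successor (inj₁ refl)            (inj₂ (inj₁ refl))           = inj₁ refl
  neighbour-of-successor (inj₁ refl)            (inj₂ (inj₂ (() , _)))
  neighbour-of-successor (inj₂ (refl , a+1≡n)) (inj₁ (inj₁ refl))           = inj₂ (inj₂ (inj₂ (a+1≡n , refl)))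
  neighbour-of-successor (inj₂ (refl , refl))  (inj₁ (inj₂ (refl , refl)))  = inj₁ refl
  neighbour-of-successor (inj₂ (refl , _))     (inj₂ (inj₁ ()))
  neighbour-of-successor (inj₂ (refl , refl))  (inj₂ (inj₂ (refl , refl)))  = inj₁ refl

  neighbour-of-predecessor : ∀ {a q b} → a < n → b < n →
                             Succℕ n q a → CycleAdjℕ n q b → EqOrTwoAfter n b a
  neighbour-of-predecessor _   _   (inj₁ refl)          (inj₁ (inj₁ refl))          = inj₁ refl
  neighbour-of-predecessor a<n _   (inj₁ refl)          (inj₁ (inj₂ (refl , refl))) = ⊥-elim (ℕₚ.<-irrefl refl a<n)
  neighbour-of-predecessor _   _   (inj₁ refl)          (inj₂ (inj₁ refl))          = inj₂ (inj₁ refl)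
  neighbour-of-predecessor _   _   (inj₁ refl)          (inj₂ (inj₂ (refl , b+1≡n))) = inj₂ (inj₂ (inj₂ (b+1≡n , refl)))
  neighbour-of-predecessor _   b<n (inj₂ (refl , refl)) (inj₁ (inj₁ refl))          = ⊥-elim (ℕₚ.<-irrefl refl b<n)
  neighbour-of-predecessor _   _   (inj₂ (refl , _))    (inj₁ (inj₂ (refl , _)))    = inj₁ refl
  neighbour-of-predecessor _   _   (inj₂ (refl , b+2≡n)) (inj₂ (inj₁ refl))         = inj₂ (inj₂ (inj₁ (refl , b+2≡n)))
  neighbour-of-predecessor _   _   (inj₂ (refl , refl)) (inj₂ (inj₂ (refl , refl))) = inj₁ refl

  -- b = a + 2 and a = b + 2 in ℤ_n would force n ∣ 4
  eqOrTwoAfter-antisym : ∀ {a b} → 3 ≤ n → n ≢ 4 → EqOrTwoAfter n a b → EqOrTwoAfter n b a → a ≡ b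
  eqOrTwoAfter-antisym _ _ (inj₁ a≡b) _ = a≡b
  eqOrTwoAfter-antisym _ _ _ (inj₁ b≡a) = sym b≡a
  eqOrTwoAfter-antisym _ _  (inj₂ (inj₁ refl)) (inj₂ (inj₁ ()))
  eqOrTwoAfter-antisym _ n≢4 (inj₂ (inj₁ refl)) (inj₂ (inj₂ (inj₁ (refl , refl)))) = ⊥-elim (n≢4 refl)
  eqOrTwoAfter-antisym _ n≢4 (inj₂ (inj₁ refl)) (inj₂ (inj₂ (inj₂ (refl , refl)))) = ⊥-elim (n≢4 refl)
  eqOrTwoAfter-antisym _ n≢4 (inj₂ (inj₂ (inj₁ (refl , refl)))) (inj₂ (inj₁ refl)) = ⊥-elim (n≢4 refl)
  eqOrTwoAfter-antisym _ _   (inj₂ (inj₂ (inj₁ (refl , _)))) (inj₂ (inj₂ (inj₁ (refl , _)))) = refl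
  eqOrTwoAfter-antisym _ n≢4 (inj₂ (inj₂ (inj₂ (refl , refl)))) (inj₂ (inj₁ refl)) = ⊥-elim (n≢4 refl)
  eqOrTwoAfter-antisym (s≤s ()) _ (inj₂ (inj₂ (inj₂ (refl , refl)))) (inj₂ (inj₂ (inj₁ (refl , _))))
  eqOrTwoAfter-antisym _ _   (inj₂ (inj₂ (inj₂ (_ , refl)))) (inj₂ (inj₂ (inj₂ (_ , refl)))) = refl

successor : ∀ {n} (i : Fin n) → Σ (Fin n) (Succ i)
successor {n} i with suc (toℕ i) ℕ.<? n
... | yes i+1<n = fromℕ< i+1<n , inj₁ (Finₚ.toℕ-fromℕ< i+1<n)
... | no i+1≮n  = fromℕ< (ℕₚ.≤-<-trans z≤n (Finₚ.toℕ<n i)) ,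
                  inj₂ (Finₚ.toℕ-fromℕ< _ , ℕₚ.≤-antisym (Finₚ.toℕ<n i) (ℕₚ.≮⇒≥ i+1≮n))

predecessor : ∀ {n} (i : Fin n) → Σ (Fin n) λ j → Succ j i
predecessor i with toℕ i in i≡
predecessor {suc m} i | zero  = fromℕ< (ℕₚ.n<1+n m) ,
                                inj₂ (refl , cong suc (Finₚ.toℕ-fromℕ< (ℕₚ.n<1+n m)))
predecessor {suc m} i | suc a = fromℕ< a<n , inj₁ (cong suc (sym (Finₚ.toℕ-fromℕ< a<n)))
  where
  a<n : a < suc m
  a<n = ℕₚ.<-trans (ℕₚ.n<1+n a) (subst (_< suc m) i≡ (Finₚ.toℕ<n i))

cycle-nbhd-injective : ∀ {n} → 3 ≤ n → n ≢ 4 → ∀ {i j : Fin n} →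
                       (∀ k → CycleAdj k i → CycleAdj k j) → i ≡ j
cycle-nbhd-injective 3≤n n≢4 {i} {j} nbhd⊆ = Finₚ.toℕ-injective
  (eqOrTwoAfter-antisym 3≤n n≢4
    (neighbour-of-successor i→i⁺ (nbhd⊆ i⁺ (inj₂ i→i⁺)))
    (neighbour-of-predecessor (Finₚ.toℕ<n i) (Finₚ.toℕ<n j) i⁻→i (nbhd⊆ i⁻ (inj₁ i⁻→i))))
  where
  i⁺ = proj₁ (successor i)
  i→i⁺ = proj₂ (successor i)
  i⁻ = proj₁ (predecessor i)
  i⁻→i = proj₂ (predecessor i)

cycleAdjℕ-nonzero : ∀ {n a b} → CycleAdjℕ n a b → a ≢ 0 → b ≤ a ⊎ b ≡ suc a
cycleAdjℕ-nonzero (inj₁ (inj₁ b≡a+1))    _   = inj₂ b≡a+1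
cycleAdjℕ-nonzero (inj₁ (inj₂ (refl , _))) _   = inj₁ z≤n
cycleAdjℕ-nonzero (inj₂ (inj₁ refl))      _   = inj₁ (ℕₚ.n≤1+n _)
cycleAdjℕ-nonzero (inj₂ (inj₂ (a≡0 , _))) a≢0 = ⊥-elim (a≢0 a≡0)

succ-opposite : ∀ {n} {i j : Fin n} → Succ i j → Succ (opposite j) (opposite i)
succ-opposite {n} {i} {j} (inj₁ j≡i+1) = inj₁ (begin
  toℕ (opposite i)             ≡⟨ Finₚ.opposite-prop i ⟩
  n ∸ suc (toℕ i)              ≡⟨ ℕₚ.+-∸-assoc 1 i+2≤n ⟩
  suc (n ∸ suc (suc (toℕ i)))  ≡⟨ cong (λ t → suc (n ∸ suc t)) (sym j≡i+1) ⟩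
  suc (n ∸ suc (toℕ j))        ≡⟨ cong suc (sym (Finₚ.opposite-prop j)) ⟩
  suc (toℕ (opposite j))       ∎)
  where
  open ≡-Reasoning
  i+2≤n : suc (suc (toℕ i)) ≤ n
  i+2≤n = subst (_≤ n) (cong suc j≡i+1) (Finₚ.toℕ<n j)
succ-opposite {n} {i} {j} (inj₂ (j≡0 , i+1≡n)) = inj₂
  ( trans (Finₚ.opposite-prop i) (trans (cong (n ∸_) i+1≡n) (ℕₚ.n∸n≡0 n))
  , (begin
      suc (toℕ (opposite j)) ≡⟨ cong suc (Finₚ.opposite-prop j) ⟩
      suc (n ∸ suc (toℕ j))  ≡⟨ cong (λ t → suc (n ∸ suc t)) j≡0 ⟩
      suc (n ∸ 1)            ≡⟨ cong (λ t → suc (t ∸ 1)) (sym i+1≡n) ⟩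
      suc (toℕ i)            ≡⟨ i+1≡n ⟩
      n                      ∎))
  where open ≡-Reasoning

cycleAdj-opposite : ∀ {n} {i j : Fin n} → CycleAdj i j → CycleAdj (opposite i) (opposite j)
cycleAdj-opposite (inj₁ i→j) = inj₂ (succ-opposite i→j)
cycleAdj-opposite (inj₂ j→i) = inj₁ (succ-opposite j→i)

succℕ? : ∀ n a b → Dec (Succℕ n a b)
succℕ? n a b = (b ℕ.≟ suc a) ⊎-dec ((b ℕ.≟ 0) ×-dec (suc a ℕ.≟ n))

cycleAdj? : ∀ {n} (i j : Fin n) → Dec (CycleAdj i j)
cycleAdj? {n} i j = succℕ? n (toℕ i) (toℕ j) ⊎-dec succℕ? n (toℕ j) (toℕ i)

-- PX(n,1) as a doubled cycle

pattern b₀ = false ∷ []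
pattern b₁ = true ∷ []

pattern i₀ = Fin.zero
pattern i₁ = Fin.suc Fin.zero
pattern i₂ = Fin.suc (Fin.suc Fin.zero)
pattern i₃ = Fin.suc (Fin.suc (Fin.suc Fin.zero))

V : ℕ → Set
V n = Vertex (PX n 0)

block : ∀ {n} → V n → Fin n
block = proj₁

PX-adj⇒cycleAdj : ∀ {n} {u v : V n} → Adj (PX n 0) u v → CycleAdj (block u) (block v)
PX-adj⇒cycleAdj (inj₁ (u→v , _)) = inj₁ u→v
PX-adj⇒cycleAdj (inj₂ (v→u , _)) = inj₂ v→u

cycleAdj⇒PX-adj : ∀ {n} {u v : V n} → CycleAdj (block u) (block v) → Adj (PX n 0) u v
cycleAdj⇒PX-adj {u = _ , x ∷ []} {_ , y ∷ []} (inj₁ u→v) = inj₁ (u→v , x , y , [] , refl , refl)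
cycleAdj⇒PX-adj {u = _ , x ∷ []} {_ , y ∷ []} (inj₂ v→u) = inj₂ (v→u , y , x , [] , refl , refl)

PX-adj-sym : ∀ {n} {u v : V n} → Adj (PX n 0) u v → Adj (PX n 0) v u
PX-adj-sym (inj₁ arc) = inj₂ arc
PX-adj-sym (inj₂ arc) = inj₁ arc

_≟V_ : ∀ {n} (u v : V n) → Dec (u ≡ v)
_≟V_ = ×ₚ.≡-dec Finₚ._≟_ (Vecₚ.≡-dec Boolₚ._≟_)

b₀≢b₁ : ∀ {n} {i : Fin n} → _≢_ {A = V n} (i , b₀) (i , b₁)
b₀≢b₁ ()

sameBlock⇒twins : ∀ {n} {u v : V n} → block u ≡ block v → Twins (PX n 0) u v
sameBlock⇒twins {u = u} {v} u≡v w = mk⇔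
  (λ w~u → cycleAdj⇒PX-adj (subst (CycleAdj (block w)) u≡v (PX-adj⇒cycleAdj w~u)))
  (λ w~v → cycleAdj⇒PX-adj (subst (CycleAdj (block w)) (sym u≡v) (PX-adj⇒cycleAdj w~v)))

PX-adj? : ∀ {n} (u v : V n) → Dec (Adj (PX n 0) u v)
PX-adj? u v = map′ cycleAdj⇒PX-adj PX-adj⇒cycleAdj (cycleAdj? (block u) (block v))

blockTwins : ∀ {n} (i : Fin n) → Twins (PX n 0) (i , b₀) (i , b₁)
blockTwins i = sameBlock⇒twins {u = i , b₀} {i , b₁} refl

twins⇒sameBlock : ∀ {n} → 3 ≤ n → n ≢ 4 → ∀ {u v : V n} → Twins (PX n 0) u v → block u ≡ block v
twins⇒sameBlock 3≤n n≢4 tw = cycle-nbhd-injective 3≤n n≢4 λ k k~u →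
  PX-adj⇒cycleAdj (Equivalence.to (tw (k , b₀)) (cycleAdj⇒PX-adj k~u))

-- n ≠ 4

module _ {n : ℕ} (3≤n : 3 ≤ n) (n≢4 : n ≢ 4) where

  zeroLayer : List (V n)
  zeroLayer = tabulate (_, b₀)

  zeroLayer-pins : Pins (PX n 0) zeroLayer
  zeroLayer-pins (i , b₀) _        i∉ _  _    = ⊥-elim (i∉ (∈ₚ.∈-tabulate⁺ i))
  zeroLayer-pins _        (j , b₀) _  j∉ _    = ⊥-elim (j∉ (∈ₚ.∈-tabulate⁺ j))
  zeroLayer-pins (i , b₁) (j , b₁) _  _  nbhd = cong (_, b₁) (sym (cycle-nbhd-injective 3≤n n≢4 λ k k~i →
    PX-adj⇒cycleAdj (nbhd (k , b₀) (∈ₚ.∈-tabulate⁺ k) (cycleAdj⇒PX-adj k~i))))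

  determining-size≥n : ∀ S → Determining (PX n 0) S → n ≤ length S
  determining-size≥n S det = injection⇒≤length {f = chosen} chosen-injective chosen∈S
    where
    chosenInS : ∀ i → Σ (V n) λ v → block v ≡ i × v ∈ S
    chosenInS i with determining-meets-twins _≟V_ PX-adj-sym (blockTwins i) b₀≢b₁ det
    ... | inj₁ v₀∈S = (i , b₀) , refl , v₀∈S
    ... | inj₂ v₁∈S = (i , b₁) , refl , v₁∈S
    chosen : Fin n → V n
    chosen i = proj₁ (chosenInS i)
    chosen∈S : ∀ i → chosen i ∈ S
    chosen∈S i = proj₂ (proj₂ (chosenInS i))
    chosen-injective : ∀ {i j} → chosen i ≡ chosen j → i ≡ j
    chosen-injective {i} {j} eq =
      trans (sym (proj₁ (proj₂ (chosenInS i)))) (trans (cong block eq) (proj₁ (proj₂ (chosenInS j))))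

  Det-PX : DetIs (PX n 0) n
  Det-PX = ( zeroLayer , Uniqueₚ.tabulate⁺ (cong block) , Listₚ.length-tabulate _
           , pins⇒determining _≟V_ PX-adj-sym zeroLayer-pins )
         , λ S _ → determining-size≥n S

-- Blocks 0 and 1 are the only ones using colour 2, each paired with a different second colour.
paint : ℕ → Bool → Fin 3
paint 0             false = # 2
paint 0             true  = # 0
paint 1             false = # 2
paint 1             true  = # 1
paint (suc (suc _)) false = # 0
paint (suc (suc _)) true  = # 1

paint-identifies-block≤1 : ∀ {a b y y′} → b ≤ 1 → paint a y ≡ paint b false → paint a y′ ≡ paint b true →
                           a ≡ b × y ≡ false × y′ ≡ true
paint-identifies-block≤1 {b = suc (suc _)} (s≤s ())
paint-identifies-block≤1 {0}           {0} {false} {true}  _ _  _  = refl , refl , refl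
paint-identifies-block≤1 {0}           {0} {false} {false} _ _  ()
paint-identifies-block≤1 {0}           {0} {true}          _ () _
paint-identifies-block≤1 {1}           {0} {false} {false} _ _  ()
paint-identifies-block≤1 {1}           {0} {false} {true}  _ _  ()
paint-identifies-block≤1 {1}           {0} {true}          _ () _
paint-identifies-block≤1 {suc (suc _)} {0} {false}         _ () _
paint-identifies-block≤1 {suc (suc _)} {0} {true}          _ () _
paint-identifies-block≤1 {1}           {1} {false} {true}  _ _  _  = refl , refl , refl
paint-identifies-block≤1 {1}           {1} {false} {false} _ _  ()
paint-identifies-block≤1 {1}           {1} {true}          _ () _
paint-identifies-block≤1 {0}           {1} {false} {false} _ _  ()
paint-identifies-block≤1 {0}           {1} {false} {true}  _ _  ()
paint-identifies-block≤1 {0}           {1} {true}          _ () _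
paint-identifies-block≤1 {suc (suc _)} {1} {false}         _ () _
paint-identifies-block≤1 {suc (suc _)} {1} {true}          _ () _

paint-injective-beyond-1 : ∀ a {y y′} → paint (suc (suc a)) y ≡ paint (suc (suc a)) y′ → y ≡ y′
paint-injective-beyond-1 _ {false} {false} _ = refl
paint-injective-beyond-1 _ {true}  {true}  _ = refl
paint-injective-beyond-1 _ {false} {true}  ()
paint-injective-beyond-1 _ {true}  {false} ()

colouring : ∀ {n} → V n → Fin 3
colouring (i , x) = paint (toℕ i) (head x)

vertex-≡ : ∀ {n} {u v : V n} → toℕ (block u) ≡ toℕ (block v) → head (proj₂ u) ≡ head (proj₂ v) → u ≡ v
vertex-≡ {u = i , _ ∷ []} {j , _ ∷ []} i≡j refl = cong (_, _) (Finₚ.toℕ-injective i≡j)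

module _ {n : ℕ} (3≤n : 3 ≤ n) (n≢4 : n ≢ 4) (σ : Aut (PX n 0))
         (σ-colouring : ∀ v → colouring (apply σ v) ≡ colouring v) where

  -- σ maps the twins of block i into a single block, which the colours identify as i itself
  fixes-blocks≤1 : ∀ {i} → toℕ i ≤ 1 → apply σ (i , b₀) ≡ (i , b₀) × apply σ (i , b₁) ≡ (i , b₁)
  fixes-blocks≤1 {i} i≤1 = identify (apply σ (i , b₀)) (apply σ (i , b₁))
    (twins⇒sameBlock 3≤n n≢4 (apply-preserves-twins σ (blockTwins i)))
    (σ-colouring (i , b₀)) (σ-colouring (i , b₁))
    where
    identify : ∀ u₀ u₁ → block u₀ ≡ block u₁ → colouring u₀ ≡ colouring (i , b₀) →
               colouring u₁ ≡ colouring (i , b₁) → u₀ ≡ (i , b₀) × u₁ ≡ (i , b₁)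
    identify (a , y ∷ []) (.a , y′ ∷ []) refl c₀ c₁ with paint-identifies-block≤1 {toℕ a} {y = y} {y′} i≤1 c₀ c₁
    ... | a≡i , refl , refl = cong (_, b₀) (Finₚ.toℕ-injective a≡i) , cong (_, b₁) (Finₚ.toℕ-injective a≡i)

  -- the block after m + 1 is its only neighbour outside the blocks ≤ m + 1
  fixes-blocks≤ : ∀ m v → toℕ (block v) ≤ suc m → apply σ v ≡ v
  fixes-blocks≤ zero (i , b₀) i≤1 = proj₁ (fixes-blocks≤1 i≤1)
  fixes-blocks≤ zero (i , b₁) i≤1 = proj₂ (fixes-blocks≤1 i≤1)
  fixes-blocks≤ (suc m) v v≤m+2 with toℕ (block v) ℕ.≤? suc m
  ... | yes v≤m+1 = fixes-blocks≤ m v v≤m+1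
  ... | no v≰m+1  = fixed-if-pinned σ (λ w → toℕ (block w) ℕ.≤? suc m) (fixes-blocks≤ m)
                      v (σ-colouring v) pinned
    where
    v≡m+2 : toℕ (block v) ≡ suc (suc m)
    v≡m+2 = ℕₚ.≤-antisym v≤m+2 (ℕₚ.≰⇒> v≰m+1)
    m+1<n : suc m < n
    m+1<n = ℕₚ.<-trans (ℕₚ.n<1+n (suc m)) (subst (_< n) v≡m+2 (Finₚ.toℕ<n (block v)))
    k : Fin n
    k = fromℕ< m+1<n
    k≡m+1 : toℕ k ≡ suc m
    k≡m+1 = Finₚ.toℕ-fromℕ< m+1<n
    pinned : ∀ w → ¬ toℕ (block w) ≤ suc m → colouring w ≡ colouring v →
             (∀ s → toℕ (block s) ≤ suc m → Adj (PX n 0) s v ⇔ Adj (PX n 0) s w) → w ≡ v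
    pinned w w≰m+1 cw≡cv nbhd with cycleAdjℕ-nonzero k~w (λ k≡0 → ℕₚ.1+n≢0 (trans (sym k≡m+1) k≡0))
      where
      k~w : CycleAdj k (block w)
      k~w = PX-adj⇒cycleAdj (Equivalence.to (nbhd (k , b₀) (ℕₚ.≤-reflexive k≡m+1))
              (cycleAdj⇒PX-adj (inj₁ (inj₁ (trans v≡m+2 (cong suc (sym k≡m+1)))))))
    ... | inj₁ w≤k = ⊥-elim (w≰m+1 (subst (_ ≤_) k≡m+1 w≤k))
    ... | inj₂ w≡k+1 = vertex-≡ w≡v (paint-injective-beyond-1 m
                         (subst₂ (λ a b → paint a (head (proj₂ w)) ≡ paint b (head (proj₂ v))) w≡m+2 v≡m+2 cw≡cv))
      where
      w≡m+2 : toℕ (block w) ≡ suc (suc m)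
      w≡m+2 = trans w≡k+1 (cong suc k≡m+1)
      w≡v : toℕ (block w) ≡ toℕ (block v)
      w≡v = trans w≡m+2 (sym v≡m+2)

colouring-distinguishing : ∀ {n} → 3 ≤ n → n ≢ 4 → Distinguishing (PX n 0) 3 colouring
colouring-distinguishing 3≤n n≢4 σ σ-colouring v =
  fixes-blocks≤ 3≤n n≢4 σ σ-colouring (toℕ (block v)) v (ℕₚ.n≤1+n _)

Fin2-other : ∀ {a b k : Fin 2} → a ≢ b → k ≢ a → k ≡ b
Fin2-other {i₀} {i₀}      a≢b _   = ⊥-elim (a≢b refl)
Fin2-other {i₁} {i₁}      a≢b _   = ⊥-elim (a≢b refl)
Fin2-other {i₀} {i₁} {i₀} _   k≢a = ⊥-elim (k≢a refl)
Fin2-other {i₀} {i₁} {i₁} _   _   = refl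
Fin2-other {i₁} {i₀} {i₀} _   _   = refl
Fin2-other {i₁} {i₀} {i₁} _   k≢a = ⊥-elim (k≢a refl)

-- With two colours separating every pair of twins, reflecting the cycle and then choosing, in
-- each block, the twin of the original colour preserves the colouring.
module Reflection {n : ℕ} (c : V n → Fin 2) (c-separates : ∀ i → c (i , b₀) ≢ c (i , b₁)) where

  bitOfColour : Fin n → Fin 2 → Vec Bool 1
  bitOfColour j k with c (j , b₀) Finₚ.≟ k
  ... | yes _ = b₀
  ... | no _  = b₁

  colour-bitOfColour : ∀ j k → c (j , bitOfColour j k) ≡ k
  colour-bitOfColour j k with c (j , b₀) Finₚ.≟ k
  ... | yes c₀≡k = c₀≡k
  ... | no c₀≢k  = sym (Fin2-other (c-separates j) (λ k≡c₀ → c₀≢k (sym k≡c₀)))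

  bitOfColour-colour : ∀ i x → bitOfColour i (c (i , x)) ≡ x
  bitOfColour-colour i b₀ with c (i , b₀) Finₚ.≟ c (i , b₀)
  ... | yes _    = refl
  ... | no c≢c   = ⊥-elim (c≢c refl)
  bitOfColour-colour i b₁ with c (i , b₀) Finₚ.≟ c (i , b₁)
  ... | yes c₀≡c₁ = ⊥-elim (c-separates i c₀≡c₁)
  ... | no _      = refl

  reflect : V n → V n
  reflect (i , x) = opposite i , bitOfColour (opposite i) (c (i , x))

  reflect-involutive : ∀ v → reflect (reflect v) ≡ v
  reflect-involutive (i , x)
    rewrite colour-bitOfColour (opposite i) (c (i , x)) | Finₚ.opposite-involutive i =
    cong (i ,_) (bitOfColour-colour i x)

  reflect-aut : Aut (PX n 0)
  reflect-aut = involution⇒aut reflect reflect-involutive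
    (λ u~v → cycleAdj⇒PX-adj (cycleAdj-opposite (PX-adj⇒cycleAdj u~v)))

  reflect-preserves-c : ∀ v → c (reflect v) ≡ c v
  reflect-preserves-c (i , x) = colour-bitOfColour (opposite i) (c (i , x))

separated-twins : ∀ {n m} {c : V n → Fin m} → Distinguishing (PX n 0) m c → ∀ i → c (i , b₀) ≢ c (i , b₁)
separated-twins dist i =
  distinguishing-separates-twins _≟V_ PX-adj-sym (blockTwins i) b₀≢b₁ dist

no-distinguishing-2-colouring : ∀ {n} → 2 ≤ n → (c : V n → Fin 2) → ¬ Distinguishing (PX n 0) 2 c
no-distinguishing-2-colouring (s≤s (s≤s _)) c dist =
  case cong block (dist reflect-aut reflect-preserves-c (i₀ , b₀)) of λ ()
  where open Reflection c (separated-twins dist)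

distinguishing-needs-3 : ∀ {n} → 2 ≤ n → ∀ m (c : V n → Fin m) → Distinguishing (PX n 0) m c → 3 ≤ m
distinguishing-needs-3 (s≤s (s≤s _)) 0 c _ = case c (i₀ , b₀) of λ ()
distinguishing-needs-3 (s≤s (s≤s _)) 1 c dist with c (i₀ , b₀) | c (i₀ , b₁) | separated-twins dist i₀
... | i₀ | i₀ | c₀≢c₁ = ⊥-elim (c₀≢c₁ refl)
distinguishing-needs-3 2≤n 2 c dist = ⊥-elim (no-distinguishing-2-colouring 2≤n c dist)
distinguishing-needs-3 _ (suc (suc (suc _))) _ _ = s≤s (s≤s (s≤s z≤n))

Dist-PX : ∀ {n} → 3 ≤ n → n ≢ 4 → DistIs (PX n 0) 3
Dist-PX 3≤n n≢4 = (colouring , colouring-distinguishing 3≤n n≢4) , distinguishing-needs-3 (ℕₚ.<⇒≤ 3≤n)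

-- n = 4

∀V₄? : {P : V 4 → Set} → (∀ v → Dec (P v)) → Dec (∀ v → P v)
∀V₄? {P} P? = map′ (λ h → λ { (i , b ∷ []) → h i b }) (λ h i b → h (i , b ∷ []))
                   (Finₚ.all? λ i → ∀Bool? λ b → P? (i , b ∷ []))
  where
  ∀Bool? : {Q : Bool → Set} → (∀ b → Dec (Q b)) → Dec (∀ b → Q b)
  ∀Bool? Q? = map′ (λ (q₀ , q₁) → λ { false → q₀ ; true → q₁ }) (λ h → h false , h true)
                   (Q? false ×-dec Q? true)

-- PX(4,1) is K₄,₄: its sides are the vertices of even and of odd blocks
even : Fin 4 → Bool
even i₀ = true
even i₁ = false
even i₂ = true
even i₃ = false

parity : V 4 → Bool
parity v = even (block v)

PX₄-adj⇒parity≢ : ∀ {u v} → Adj (PX 4 0) u v → parity u ≢ parity v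
PX₄-adj⇒parity≢ u~v = cycleAdj⇒even≢ _ _ (PX-adj⇒cycleAdj u~v)
  where
  cycleAdj⇒even≢ : ∀ i j → CycleAdj i j → even i ≢ even j
  cycleAdj⇒even≢ = from-yes (Finₚ.all? λ i → Finₚ.all? λ j → cycleAdj? i j →-dec ¬? (even i Boolₚ.≟ even j))

parity≢⇒PX₄-adj : ∀ {u v} → parity u ≢ parity v → Adj (PX 4 0) u v
parity≢⇒PX₄-adj p≢ = cycleAdj⇒PX-adj (even≢⇒cycleAdj _ _ p≢)
  where
  even≢⇒cycleAdj : ∀ i j → even i ≢ even j → CycleAdj i j
  even≢⇒cycleAdj = from-yes (Finₚ.all? λ i → Finₚ.all? λ j → ¬? (even i Boolₚ.≟ even j) →-dec cycleAdj? i j)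

sameParity⇒twins : ∀ {u v} → parity u ≡ parity v → Twins (PX 4 0) u v
sameParity⇒twins pu≡pv w = mk⇔
  (λ w~u → parity≢⇒PX₄-adj λ pw≡pv → PX₄-adj⇒parity≢ w~u (trans pw≡pv (sym pu≡pv)))
  (λ w~v → parity≢⇒PX₄-adj λ pw≡pu → PX₄-adj⇒parity≢ w~v (trans pw≡pu pu≡pv))

sideVertex : Bool → Fin 4 → V 4
sideVertex true  i₀ = i₀ , b₀
sideVertex true  i₁ = i₀ , b₁
sideVertex true  i₂ = i₂ , b₀
sideVertex true  i₃ = i₂ , b₁
sideVertex false i₀ = i₁ , b₀
sideVertex false i₁ = i₁ , b₁
sideVertex false i₂ = i₃ , b₀
sideVertex false i₃ = i₃ , b₁

parity-sideVertex : ∀ s k → parity (sideVertex s k) ≡ s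
parity-sideVertex true  = from-yes (Finₚ.all? λ k → parity (sideVertex true k) Boolₚ.≟ true)
parity-sideVertex false = from-yes (Finₚ.all? λ k → parity (sideVertex false k) Boolₚ.≟ false)

sideVertex-injective : ∀ s {k l} → sideVertex s k ≡ sideVertex s l → k ≡ l
sideVertex-injective s {k} {l} = injective s k l
  where
  injective : ∀ s k l → sideVertex s k ≡ sideVertex s l → k ≡ l
  injective true  = from-yes (Finₚ.all? λ k → Finₚ.all? λ l → (sideVertex true k ≟V sideVertex true l) →-dec (k Finₚ.≟ l))
  injective false = from-yes (Finₚ.all? λ k → Finₚ.all? λ l → (sideVertex false k ≟V sideVertex false l) →-dec (k Finₚ.≟ l))

side : Bool → List (V 4)
side s = tabulate (sideVertex s)

side-twinClass : ∀ s → AllPairs (λ x y → x ≢ y × Twins (PX 4 0) x y) (side s)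
side-twinClass s = AllPairs.map (λ (x≢y , px≡py) → x≢y , sameParity⇒twins px≡py) (sameParity s)
  where
  sameParity? : ∀ s → Dec (AllPairs (λ x y → x ≢ y × parity x ≡ parity y) (side s))
  sameParity? s = AllPairs.allPairs? (λ x y → ¬? (x ≟V y) ×-dec (parity x Boolₚ.≟ parity y)) (side s)
  sameParity : ∀ s → AllPairs (λ x y → x ≢ y × parity x ≡ parity y) (side s)
  sameParity true  = from-yes (sameParity? true)
  sameParity false = from-yes (sameParity? false)

-- all but one vertex of each side
S₄ : List (V 4)
S₄ = (i₀ , b₀) ∷ (i₀ , b₁) ∷ (i₂ , b₀) ∷ (i₁ , b₀) ∷ (i₁ , b₁) ∷ (i₃ , b₀) ∷ []

S₄-pins : Pins (PX 4 0) S₄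
S₄-pins = from-yes (∀V₄? λ v → ∀V₄? λ w → ¬? (v ∈S₄?) →-dec (¬? (w ∈S₄?) →-dec
            ((∀V₄? λ s → (s ∈S₄?) →-dec (PX-adj? s v →-dec PX-adj? s w)) →-dec (w ≟V v))))
  where
  _∈S₄? : ∀ v → Dec (v ∈ S₄)
  v ∈S₄? = ∈?[ _≟V_ ] v S₄

determining₄-size≥6 : ∀ S → Determining (PX 4 0) S → 6 ≤ length S
determining₄-size≥6 S det = begin
  6                                                 ≤⟨ ℕₚ.+-mono-≤ (ℕ.s≤s⁻¹ (omits true)) (ℕ.s≤s⁻¹ (omits false)) ⟩
  length (inS (side true)) + length (inS (side false)) ≡⟨ sym (Listₚ.length-++ (inS (side true))) ⟩
  length (inS (side true) ++ inS (side false))      ≡⟨ cong length (sym (Listₚ.filter-++ inS? (side true) (side false))) ⟩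
  length (inS (side true ++ side false))            ≤⟨ unique-⊆⇒length≤ (Uniqueₚ.filter⁺ inS? sides-unique)
                                                         (λ x∈ → proj₂ (∈ₚ.∈-filter⁻ inS? x∈)) ⟩
  length S                                          ∎
  where
  open ℕₚ.≤-Reasoning
  inS? : ∀ x → Dec (x ∈ S)
  inS? x = ∈?[ _≟V_ ] x S
  inS : List (V 4) → List (V 4)
  inS = filter inS?
  omits : ∀ s → 4 ≤ suc (length (inS (side s)))
  omits s = determining-omits-≤1-twin _≟V_ PX-adj-sym det (side-twinClass s)
  sides-unique : Unique (side true ++ side false)
  sides-unique = from-yes (unique? _≟V_ (side true ++ side false))

Det-PX₄ : DetIs (PX 4 0) 6
Det-PX₄ = (S₄ , from-yes (unique? _≟V_ S₄) , refl , pins⇒determining _≟V_ PX-adj-sym S₄-pins)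
        , λ S _ → determining₄-size≥6 S

-- (i₃ , b₁) is the only vertex of colour 4; adjacency to it tells the sides apart, and within a
-- side the colours are distinct
fiveColouring : V 4 → Fin 5
fiveColouring (i₀ , b₀) = # 0
fiveColouring (i₀ , b₁) = # 1
fiveColouring (i₂ , b₀) = # 2
fiveColouring (i₂ , b₁) = # 3
fiveColouring (i₁ , b₀) = # 0
fiveColouring (i₁ , b₁) = # 1
fiveColouring (i₃ , b₀) = # 2
fiveColouring (i₃ , b₁) = # 4

fiveColouring-distinguishing : Distinguishing (PX 4 0) 5 fiveColouring
fiveColouring-distinguishing σ σ-colouring v =
  fixed-if-pinned σ (_≟V t) fixes-t v (σ-colouring v) λ w w≢t cw≡cv nbhd → pinned v w w≢t cw≡cv (nbhd t refl)
  where
  t : V 4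
  t = i₃ , b₁
  unique-colour : ∀ w → fiveColouring w ≡ fiveColouring t → w ≡ t
  unique-colour = from-yes (∀V₄? λ w → (fiveColouring w Finₚ.≟ fiveColouring t) →-dec (w ≟V t))
  fixes-t : ∀ s → s ≡ t → apply σ s ≡ s
  fixes-t _ refl = unique-colour _ (σ-colouring t)
  pinned : ∀ v w → w ≢ t → fiveColouring w ≡ fiveColouring v → Adj (PX 4 0) t v ⇔ Adj (PX 4 0) t w → w ≡ v
  pinned = from-yes (∀V₄? λ v → ∀V₄? λ w → ¬? (w ≟V t) →-dec ((fiveColouring w Finₚ.≟ fiveColouring v) →-dec
             (map′ (λ (to , from) → mk⇔ to from) (λ e → Equivalence.to e , Equivalence.from e)
                   ((PX-adj? t v →-dec PX-adj? t w) ×-dec (PX-adj? t w →-dec PX-adj? t v)) →-dec (w ≟V v))))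

module _ {m : ℕ} {c : V 4 → Fin m} (dist : Distinguishing (PX 4 0) m c) where

  colour-injective-on-sides : ∀ {u v} → parity u ≡ parity v → c u ≡ c v → u ≡ v
  colour-injective-on-sides {u} {v} pu≡pv cu≡cv with u ≟V v
  ... | yes u≡v = u≡v
  ... | no u≢v  = ⊥-elim (distinguishing-separates-twins _≟V_ PX-adj-sym (sameParity⇒twins pu≡pv) u≢v dist cu≡cv)

  side-colours-injective : ∀ s {k l} → c (sideVertex s k) ≡ c (sideVertex s l) → k ≡ l
  side-colours-injective s = sideVertex-injective s ∘
    colour-injective-on-sides (trans (parity-sideVertex s _) (sym (parity-sideVertex s _)))

  distinguishing₄-needs-4 : 4 ≤ m
  distinguishing₄-needs-4 = Finₚ.injective⇒≤ (side-colours-injective true)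

-- Four colours used injectively on each side are all four colours on each side, so matching
-- equal colours across the sides exchanges the sides of K₄,₄ while preserving the colouring.
module SideExchange {c : V 4 → Fin 4} (dist : Distinguishing (PX 4 0) 4 c) where

  partnerIndex : ∀ v → Σ (Fin 4) λ k → c (sideVertex (not (parity v)) k) ≡ c v
  partnerIndex v = injective⇒surjective (side-colours-injective dist (not (parity v))) (c v)

  partner : V 4 → V 4
  partner v = sideVertex (not (parity v)) (proj₁ (partnerIndex v))

  colour-partner : ∀ v → c (partner v) ≡ c v
  colour-partner v = proj₂ (partnerIndex v)

  parity-partner : ∀ v → parity (partner v) ≡ not (parity v)
  parity-partner v = parity-sideVertex (not (parity v)) _

  partner-involutive : ∀ v → partner (partner v) ≡ v
  partner-involutive v = colour-injective-on-sides dist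
    (trans (parity-partner (partner v)) (trans (cong not (parity-partner v)) (Boolₚ.not-involutive (parity v))))
    (trans (colour-partner (partner v)) (colour-partner v))

  partner-aut : Aut (PX 4 0)
  partner-aut = involution⇒aut partner partner-involutive λ {u} {v} u~v →
    parity≢⇒PX₄-adj λ pu′≡pv′ → PX₄-adj⇒parity≢ u~v (not-injective
      (trans (sym (parity-partner u)) (trans pu′≡pv′ (parity-partner v))))
    where
    not-injective : ∀ {a b} → not a ≡ not b → a ≡ b
    not-injective {a} {b} eq =
      trans (sym (Boolₚ.not-involutive a)) (trans (cong not eq) (Boolₚ.not-involutive b))

no-distinguishing₄-4-colouring : (c : V 4 → Fin 4) → ¬ Distinguishing (PX 4 0) 4 c
no-distinguishing₄-4-colouring c dist =
  case trans (sym (parity-partner v₀)) (cong parity (dist partner-aut colour-partner v₀)) of λ ()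
  where
  open SideExchange dist
  v₀ : V 4
  v₀ = i₀ , b₀

distinguishing₄-needs-5 : ∀ m (c : V 4 → Fin m) → Distinguishing (PX 4 0) m c → 5 ≤ m
distinguishing₄-needs-5 m c dist =
  ℕₚ.≤∧≢⇒< (distinguishing₄-needs-4 dist) λ { refl → no-distinguishing₄-4-colouring c dist }

Dist-PX₄ : DistIs (PX 4 0) 5
Dist-PX₄ = (fiveColouring , fiveColouring-distinguishing) , distinguishing₄-needs-5

theorem3p4 : (DetIs (PX 4 0) 6 × DistIs (PX 4 0) 5)
    × (∀ (n : ℕ) → 3 ≤ n → n ≢ 4 → DetIs (PX n 0) n × DistIs (PX n 0) 3)
theorem3p4 = (Det-PX₄ , Dist-PX₄) , λ n 3≤n n≢4 → Det-PX 3≤n n≢4 , Dist-PX 3≤n n≢4
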